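{- Let $\{A_1,\dots,A_m\}$ be an $(n,m;k_1,\dots,k_m;\ell)$-RWEDF in a finite abelian group $G$ of order $n$ with $\ell\in\mathbb{Z}$ and $k_1,\dots,k_m$ pairwise coprime. Then $\{A_1,\dots,A_m\}$ is bimodal.
   Context: $G$ is written additively, $G^*=G\setminus\{0\}$. For pairwise disjoint nonempty subsets $A_1,\dots,A_m$ of $G$ and $\delta\in G^*$, let $N_i(\delta)=|\{(a_i,a_j): a_i\in A_i,\ a_j\in A_j \text{ for some } j\neq i,\ a_i-a_j=\delta\}|$. An $(n,m;k_1,\dots,k_m;\ell)$-RWEDF is a collection of pairwise disjoint subsets with $|A_i|=k_i$ such that $\sum_i \frac{1}{k_i}N_i(\delta)=\ell$ for all $\delta\in G^*$. A collection $A_1,\dots,A_m$ of disjoint subsets with $|A_j|=k_j$ is bimodal if $N_j(\delta)\in\{0,k_j\}$ for all $\delta\in G^*$ and all $j$. -}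

module Defs where

open import Data.Nat using (ℕ; zero; suc)
open import Data.Integer using (ℤ; +_)
open import Data.Rational using (ℚ; 0ℚ; _+_; _/_)
open import Data.Fin using (Fin; zero; suc; _≟_)
open import Data.Fin.Subset using (Subset; _∈_; _∉_; ∣_∣; Nonempty)
open import Data.Fin.Subset.Properties using (_∈?_)
open import Data.List using (List; length; filter; cartesianProduct; allFin)
open import Data.Product using (_×_; _,_; proj₁; proj₂; ∃-syntax)
open import Relation.Nullary using (¬_; Dec; yes; no)
open import Relation.Nullary.Decidable using (_×-dec_; ¬?)
open import Relation.Binary.PropositionalEquality using (_≡_; _≢_)
open import Algebra.Structures using (IsAbelianGroup)
open import Data.Fin.Properties using (any?)

-- A finite abelian group of order n, with carrier Fin n (every finite
-- abelian group of order n is isomorphic to one of this form).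
record FinAbGroup (n : ℕ) : Set where
  field
    _⊕_ : Fin n → Fin n → Fin n
    𝟘   : Fin n
    ⊖_  : Fin n → Fin n
    isAbelianGroup : IsAbelianGroup _≡_ _⊕_ 𝟘 ⊖_

  _⊝_ : Fin n → Fin n → Fin n
  x ⊝ y = x ⊕ (⊖ y)

  infixl 6 _⊕_ _⊝_

open FinAbGroup public

InOther : ∀ {n m} → (Fin m → Subset n) → Fin m → Fin n → Set
InOther A i y = ∃[ j ] (j ≢ i × y ∈ A j)

inOther? : ∀ {n m} (A : Fin m → Subset n) (i : Fin m) (y : Fin n) → Dec (InOther A i y)
inOther? A i y = any? (λ j → ¬? (j ≟ i) ×-dec (y ∈? A j))

N : ∀ {n m} → FinAbGroup n → (Fin m → Subset n) → Fin m → Fin n → ℕ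
N {n} G A i δ = length (filter P? (cartesianProduct (allFin n) (allFin n)))
  where
  P? : (p : Fin n × Fin n) → Dec ((proj₁ p ∈ A i × InOther A i (proj₂ p))
                                   × (_⊝_ G (proj₁ p) (proj₂ p) ≡ δ))
  P? (x , y) = ((x ∈? A i) ×-dec inOther? A i y) ×-dec (_⊝_ G x y ≟ δ)

-- a / k as a rational (k = 0 never occurs for nonempty blocks; convention 0)
frac : ℕ → ℕ → ℚ
frac a zero    = 0ℚ
frac a (suc k) = (+ a) / suc k

sumℚ : ∀ {m} → (Fin m → ℚ) → ℚ
sumℚ {zero}  f = 0ℚ
sumℚ {suc m} f = f zero + sumℚ (λ i → f (suc i))

IsRWEDF : ∀ {n m} → FinAbGroup n → (Fin m → Subset n) → (Fin m → ℕ) → ℤ → Set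
IsRWEDF {n} {m} G A k ℓ =
    (∀ i j → i ≢ j → ∀ x → x ∈ A i → x ∉ A j)
  × (∀ i → Nonempty (A i))
  × (∀ i → ∣ A i ∣ ≡ k i)
  × (∀ (δ : Fin n) → δ ≢ 𝟘 G → sumℚ (λ i → frac (N G A i δ) (k i)) ≡ (ℓ / 1))

IsBimodal : ∀ {n m} → FinAbGroup n → (Fin m → Subset n) → (Fin m → ℕ) → Set
IsBimodal {n} {m} G A k =
  ∀ (j : Fin m) (δ : Fin n) → δ ≢ 𝟘 G → (N G A j δ ≡ 0) Data.Sum.⊎ (N G A j δ ≡ k j)
  where import Data.Sum

module Submission where

-- Fix a block j and δ ≠ 0.  Two independent facts combine:
--
--  * Counting.  In a group, a - b = δ determines b from a, so every a ∈ A_j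
--    has at most one partner and N_j(δ) ≤ |A_j| = k_j.
--
--  * Denominators.  Write "d · q ∈ℤ" when d times the rational q is an
--    integer.  Each summand N_i(δ)/k_i satisfies k_i · (N_i/k_i) ∈ℤ, so the
--    summands with i ≠ j add up to some r with e · r ∈ℤ, where e = ∏_{i≠j} k_i
--    is coprime to k_j.  Since the whole sum is the integer ℓ,
--    N_j/k_j = ℓ - r, hence (e·e) · (N_j/k_j) ∈ℤ, i.e. k_j ∣ e·e·N_j, and by
--    coprimality k_j ∣ N_j.
--
-- With 0 ≤ N_j(δ) ≤ k_j this forces N_j(δ) ∈ {0, k_j}.

open import Defs
open import Data.Nat.Coprimality using (Coprime)
open import Data.Integer using (ℤ)
open import Data.Fin using (Fin)
open import Data.Fin.Subset using (Subset)
open import Relation.Binary.PropositionalEquality using (_≢_)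

open import Data.Nat as ℕ using (ℕ; zero; suc; _≤_; z≤n; s≤s)
import Data.Nat.Properties as ℕP
open import Data.Nat.Coprimality using (coprime-divisor; 1-coprimeTo)
import Data.Nat.Coprimality as Coprime
open import Data.Nat.Divisibility using (_∣_; ∣-trans; divides; ∣⇒≤)
open import Data.Integer as ℤ using (+_)
import Data.Integer.Properties as ℤP
open import Data.Integer.Solver using (module +-*-Solver)
open import Data.Rational as ℚ using (ℚ; toℚᵘ)
import Data.Rational.Properties as ℚP
open import Data.Rational.Unnormalised as ℚᵘ using (ℚᵘ; mkℚᵘ; ↥_; ↧_; _≃_; *≡*)
import Data.Rational.Unnormalised.Properties as ℚᵘP
open import Data.Fin using (zero; suc)
open import Data.Fin.Properties using (suc-injective)
open import Data.Fin.Subset using (_∈_; ∣_∣; inside; outside)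
open import Data.Fin.Subset.Properties using (_∈?_; drop-there)
open import Data.List using (List; []; _∷_; length; filter; map; _++_; tabulate; cartesianProduct; allFin)
import Data.List.Properties as ListP
open import Data.List.Relation.Unary.All as All using (All)
open import Data.List.Relation.Unary.All.Properties using (map⁺)
open import Data.List.Relation.Unary.AllPairs using ([]; _∷_)
open import Data.List.Relation.Unary.Unique.Propositional using (Unique)
open import Data.List.Relation.Unary.Unique.Propositional.Properties using (allFin⁺)
open import Data.Product using (_×_; _,_; proj₁; proj₂; ∃; Σ-syntax)
open import Data.Sum using (_⊎_; inj₁; inj₂)
open import Data.Vec using ([]; _∷_)
open import Relation.Binary.PropositionalEquality using (_≡_; refl; sym; trans; cong; cong₂; subst; module ≡-Reasoning)
open import Relation.Nullary using (¬_; Dec; yes; no)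
open import Relation.Unary using (Decidable)
open import Algebra.Bundles using (Group)
import Algebra.Properties.Group as GroupProperties
open import Algebra.Structures using (IsAbelianGroup)

coprime-* : ∀ {c a b} → Coprime c a → Coprime c b → Coprime c (a ℕ.* b)
coprime-* {a = a} c⊥a c⊥b (d∣c , d∣ab) =
  c⊥b (d∣c , coprime-divisor {n = a} (λ (e∣d , e∣a) → c⊥a (∣-trans e∣d d∣c , e∣a)) d∣ab)

_·_∈ℤ : ℕ → ℚᵘ → Set
d · q ∈ℤ = ∃ λ t → (↥ q) ℤ.* (+ d) ≡ t ℤ.* (↧ q)

infix 4 _·_∈ℤ

·∈ℤ-neg : ∀ {d} q → d · q ∈ℤ → d · (ℚᵘ.- q) ∈ℤ
·∈ℤ-neg {d} (mkℚᵘ p c) (t , pd≡tc) = ℤ.- t , (begin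
    (ℤ.- p) ℤ.* + d     ≡⟨ ℤP.neg-distribˡ-* p (+ d) ⟨
    ℤ.- (p ℤ.* + d)     ≡⟨ cong ℤ.-_ pd≡tc ⟩
    ℤ.- (t ℤ.* + suc c) ≡⟨ ℤP.neg-distribˡ-* t (+ suc c) ⟩
    (ℤ.- t) ℤ.* + suc c ∎)
  where open ≡-Reasoning

·∈ℤ-+ : ∀ {d₁ d₂} q₁ q₂ → d₁ · q₁ ∈ℤ → d₂ · q₂ ∈ℤ → (d₁ ℕ.* d₂) · (q₁ ℚᵘ.+ q₂) ∈ℤ
·∈ℤ-+ {d₁} {d₂} (mkℚᵘ p₁ c₁) (mkℚᵘ p₂ c₂) (t₁ , eq₁) (t₂ , eq₂) =
  t₁ ℤ.* + d₂ ℤ.+ t₂ ℤ.* + d₁ , (begin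
    (p₁ ℤ.* e₂ ℤ.+ p₂ ℤ.* e₁) ℤ.* + (d₁ ℕ.* d₂)
      ≡⟨ cong ((p₁ ℤ.* e₂ ℤ.+ p₂ ℤ.* e₁) ℤ.*_) (ℤP.pos-* d₁ d₂) ⟩
    (p₁ ℤ.* e₂ ℤ.+ p₂ ℤ.* e₁) ℤ.* (+ d₁ ℤ.* + d₂)
      ≡⟨ solve 6 (λ p₁ p₂ e₁ e₂ x₁ x₂ →
            (p₁ :* e₂ :+ p₂ :* e₁) :* (x₁ :* x₂) :=
            (p₁ :* x₁) :* (e₂ :* x₂) :+ (p₂ :* x₂) :* (e₁ :* x₁))
          refl p₁ p₂ e₁ e₂ (+ d₁) (+ d₂) ⟩
    (p₁ ℤ.* + d₁) ℤ.* (e₂ ℤ.* + d₂) ℤ.+ (p₂ ℤ.* + d₂) ℤ.* (e₁ ℤ.* + d₁)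
      ≡⟨ cong₂ (λ a b → a ℤ.* (e₂ ℤ.* + d₂) ℤ.+ b ℤ.* (e₁ ℤ.* + d₁)) eq₁ eq₂ ⟩
    (t₁ ℤ.* e₁) ℤ.* (e₂ ℤ.* + d₂) ℤ.+ (t₂ ℤ.* e₂) ℤ.* (e₁ ℤ.* + d₁)
      ≡⟨ solve 6 (λ t₁ t₂ e₁ e₂ x₁ x₂ →
            (t₁ :* e₁) :* (e₂ :* x₂) :+ (t₂ :* e₂) :* (e₁ :* x₁) :=
            (t₁ :* x₂ :+ t₂ :* x₁) :* (e₁ :* e₂))
          refl t₁ t₂ e₁ e₂ (+ d₁) (+ d₂) ⟩
    (t₁ ℤ.* + d₂ ℤ.+ t₂ ℤ.* + d₁) ℤ.* (e₁ ℤ.* e₂)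
      ≡⟨ cong ((t₁ ℤ.* + d₂ ℤ.+ t₂ ℤ.* + d₁) ℤ.*_) (ℤP.pos-* (suc c₁) (suc c₂)) ⟨
    (t₁ ℤ.* + d₂ ℤ.+ t₂ ℤ.* + d₁) ℤ.* + (suc c₁ ℕ.* suc c₂) ∎)
  where
  open ≡-Reasoning
  open +-*-Solver
  e₁ = + suc c₁
  e₂ = + suc c₂

·∈ℤ-resp-≃ : ∀ {d q q'} → q ≃ q' → d · q ∈ℤ → d · q' ∈ℤ
·∈ℤ-resp-≃ {d} {mkℚᵘ p c} {mkℚᵘ p' c'} (*≡* pc'≡p'c) (t , pd≡tc) =
  t , ℤP.*-cancelʳ-≡ _ _ (+ suc c) (begin
    p' ℤ.* + d ℤ.* + suc c      ≡⟨ swap₂₃ p' (+ d) (+ suc c) ⟩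
    p' ℤ.* + suc c ℤ.* + d      ≡⟨ cong (ℤ._* + d) pc'≡p'c ⟨
    p ℤ.* + suc c' ℤ.* + d      ≡⟨ swap₂₃ p (+ suc c') (+ d) ⟩
    p ℤ.* + d ℤ.* + suc c'      ≡⟨ cong (ℤ._* + suc c') pd≡tc ⟩
    t ℤ.* + suc c ℤ.* + suc c'  ≡⟨ swap₂₃ t (+ suc c) (+ suc c') ⟩
    t ℤ.* + suc c' ℤ.* + suc c  ∎)
  where
  open ≡-Reasoning
  swap₂₃ : ∀ a b x → a ℤ.* b ℤ.* x ≡ a ℤ.* x ℤ.* b
  swap₂₃ = +-*-Solver.solve 3 (λ a b x → a :* b :* x := a :* x :* b) refl
    where open +-*-Solver

·∈ℤ-integer : ∀ d ℓ → d · mkℚᵘ ℓ 0 ∈ℤ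
·∈ℤ-integer d ℓ = ℓ ℤ.* + d , sym (ℤP.*-identityʳ _)

·∈ℤ⇒∣ : ∀ {d} a c → d · mkℚᵘ (+ a) c ∈ℤ → suc c ∣ d ℕ.* a
·∈ℤ⇒∣ {d} a c (t , ad≡tk) = divides ℤ.∣ t ∣ (begin
    d ℕ.* a                ≡⟨ ℕP.*-comm d a ⟩
    a ℕ.* d                ≡⟨ ℤP.abs-* (+ a) (+ d) ⟨
    ℤ.∣ + a ℤ.* + d ∣      ≡⟨ cong ℤ.∣_∣ ad≡tk ⟩
    ℤ.∣ t ℤ.* + suc c ∣    ≡⟨ ℤP.abs-* t (+ suc c) ⟩
    ℤ.∣ t ∣ ℕ.* suc c      ∎)
  where open ≡-Reasoning

sumᵘ : ∀ {m} → (Fin m → ℚᵘ) → ℚᵘ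
sumᵘ {zero}  f = ℚᵘ.0ℚᵘ
sumᵘ {suc m} f = f zero ℚᵘ.+ sumᵘ (λ i → f (suc i))

prodℕ : ∀ {m} → (Fin m → ℕ) → ℕ
prodℕ {zero}  f = 1
prodℕ {suc m} f = f zero ℕ.* prodℕ (λ i → f (suc i))

toℚᵘ-sumℚ : ∀ {m} (f : Fin m → ℚ) → toℚᵘ (sumℚ f) ≃ sumᵘ (λ i → toℚᵘ (f i))
toℚᵘ-sumℚ {zero}  f = ℚᵘP.≃-refl
toℚᵘ-sumℚ {suc m} f = ℚᵘP.≃-trans (ℚP.toℚᵘ-homo-+ (f zero) (sumℚ (λ i → f (suc i))))
  (ℚᵘP.+-congʳ (toℚᵘ (f zero)) (toℚᵘ-sumℚ (λ i → f (suc i))))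

·∈ℤ-sum : ∀ {m} (g : Fin m → ℚᵘ) (d : Fin m → ℕ) → (∀ i → d i · g i ∈ℤ) → prodℕ d · sumᵘ g ∈ℤ
·∈ℤ-sum {zero}  g d _   = + 0 , refl
·∈ℤ-sum {suc m} g d d·g = ·∈ℤ-+ (g zero) _ (d·g zero) (·∈ℤ-sum _ _ (λ i → d·g (suc i)))

coprime-prod : ∀ {m} c (d : Fin m → ℕ) → (∀ i → Coprime c (d i)) → Coprime c (prodℕ d)
coprime-prod {zero}  c d _   = Coprime.sym (1-coprimeTo c)
coprime-prod {suc m} c d c⊥d = coprime-* (c⊥d zero) (coprime-prod c _ (λ i → c⊥d (suc i)))

isolate-summand : ∀ {m} (g : Fin m → ℚᵘ) (d : Fin m → ℕ) → (∀ i → d i · g i ∈ℤ)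
  → (∀ i j → i ≢ j → Coprime (d i) (d j)) → (j : Fin m)
  → Σ[ r ∈ ℚᵘ ] Σ[ e ∈ ℕ ] (sumᵘ g ≃ g j ℚᵘ.+ r) × e · r ∈ℤ × Coprime (d j) e
isolate-summand {suc m} g d d·g cop zero =
  sumᵘ (λ i → g (suc i)) , prodℕ (λ i → d (suc i)) , ℚᵘP.≃-refl ,
  ·∈ℤ-sum _ _ (λ i → d·g (suc i)) , coprime-prod _ _ (λ i → cop zero (suc i) (λ ()))
isolate-summand {suc m} g d d·g cop (suc j)
  with isolate-summand (λ i → g (suc i)) (λ i → d (suc i)) (λ i → d·g (suc i))
         (λ a b a≢b → cop (suc a) (suc b) (λ sa≡sb → a≢b (suc-injective sa≡sb))) j
... | r , e , sum≃ , e·r , dj⊥e =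
  g zero ℚᵘ.+ r , d zero ℕ.* e ,
  ℚᵘP.≃-trans (ℚᵘP.+-congʳ (g zero) sum≃) (swap-front (g zero) (g (suc j)) r) ,
  ·∈ℤ-+ (g zero) r (d·g zero) e·r , coprime-* (cop (suc j) zero (λ ())) dj⊥e
  where
  swap-front : ∀ a b c → a ℚᵘ.+ (b ℚᵘ.+ c) ≃ b ℚᵘ.+ (a ℚᵘ.+ c)
  swap-front a b c = ℚᵘP.≃-trans (ℚᵘP.≃-sym (ℚᵘP.+-assoc a b c))
    (ℚᵘP.≃-trans (ℚᵘP.+-congˡ c (ℚᵘP.+-comm a b)) (ℚᵘP.+-assoc b a c))

solve-for-summand : ∀ a r L → a ℚᵘ.+ r ≃ L → a ≃ L ℚᵘ.- r
solve-for-summand a r L a+r≃L = begin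
  a                        ≈⟨ ℚᵘP.+-identityʳ a ⟨
  a ℚᵘ.+ ℚᵘ.0ℚᵘ            ≈⟨ ℚᵘP.+-congʳ a (ℚᵘP.+-inverseʳ r) ⟨
  a ℚᵘ.+ (r ℚᵘ.- r)        ≈⟨ ℚᵘP.+-assoc a r (ℚᵘ.- r) ⟨
  (a ℚᵘ.+ r) ℚᵘ.- r        ≈⟨ ℚᵘP.+-congˡ (ℚᵘ.- r) a+r≃L ⟩
  L ℚᵘ.- r                 ∎
  where open ℚᵘP.≃-Reasoning

frac-≃ : ∀ a c → toℚᵘ (frac a (suc c)) ≃ mkℚᵘ (+ a) c
frac-≃ a c = ℚP.toℚᵘ-fromℚᵘ (mkℚᵘ (+ a) c)

·∈ℤ-frac : ∀ a k → k · toℚᵘ (frac a k) ∈ℤ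
·∈ℤ-frac a zero    = + 0 , refl
·∈ℤ-frac a (suc c) = ·∈ℤ-resp-≃ (ℚᵘP.≃-sym (frac-≃ a c)) (+ a , refl)

·∈ℤ-int : ∀ d ℓ → d · toℚᵘ (ℓ ℚ./ 1) ∈ℤ
·∈ℤ-int d ℓ = ·∈ℤ-resp-≃ (ℚᵘP.≃-sym (ℚP.toℚᵘ-fromℚᵘ (mkℚᵘ ℓ 0))) (·∈ℤ-integer d ℓ)

·∈ℤ-complement : ∀ {e} a r ℓ → a ℚᵘ.+ r ≃ toℚᵘ (ℓ ℚ./ 1) → e · r ∈ℤ → (e ℕ.* e) · a ∈ℤ
·∈ℤ-complement {e} a r ℓ a+r≃ℓ e·r =
  ·∈ℤ-resp-≃ (ℚᵘP.≃-sym (solve-for-summand a r _ a+r≃ℓ))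
    (·∈ℤ-+ (toℚᵘ (ℓ ℚ./ 1)) (ℚᵘ.- r) (·∈ℤ-int e ℓ) (·∈ℤ-neg r e·r))

frac-extremal : ∀ a k e → a ≤ k → e · toℚᵘ (frac a k) ∈ℤ → Coprime k e → a ≡ 0 ⊎ a ≡ k
frac-extremal a       zero    e a≤0 _   _    = inj₁ (ℕP.n≤0⇒n≡0 a≤0)
frac-extremal zero    (suc c) e _   _   _    = inj₁ refl
frac-extremal (suc a) (suc c) e a≤k e·q k⊥e  = inj₂ (ℕP.≤-antisym a≤k (∣⇒≤ k∣a))
  where
  k∣a : suc c ∣ suc a
  k∣a = coprime-divisor k⊥e (·∈ℤ⇒∣ (suc a) c (·∈ℤ-resp-≃ (frac-≃ (suc a) c) e·q))

members-≤ : ∀ {m n} (B : Subset n) (p : Subset m) (f : Fin m → Fin n)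
  → (∀ x → f x ∈ B → x ∈ p) → length (filter (_∈? B) (tabulate f)) ≤ ∣ p ∣
members-≤ B []            f _    = z≤n
members-≤ B (outside ∷ p) f f∈B⇒ with f zero ∈? B
... | yes f0∈B with () ← f∈B⇒ zero f0∈B
... | no _     = members-≤ B p (λ x → f (suc x)) (λ x fx∈B → drop-there (f∈B⇒ (suc x) fx∈B))
members-≤ B (inside ∷ p)  f f∈B⇒
  with f zero ∈? B | members-≤ B p (λ x → f (suc x)) (λ x fx∈B → drop-there (f∈B⇒ (suc x) fx∈B))
... | yes _ | rest = s≤s rest
... | no _  | rest = ℕP.m≤n⇒m≤1+n rest

module FunctionalPairCount {n} {Q : Fin n × Fin n → Set} (Q? : Decidable Q) (B : Subset n)
  (first∈B : ∀ {x y} → Q (x , y) → x ∈ B)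
  (functional : ∀ {x y y'} → Q (x , y) → Q (x , y') → y ≡ y') where

  row : Fin n → List (Fin n) → ℕ
  row x ys = length (filter Q? (map (x ,_) ys))

  row-empty : ∀ {x} ys → All (λ y → ¬ Q (x , y)) ys → row x ys ≡ 0
  row-empty ys none = cong length (ListP.filter-none Q? (map⁺ none))

  row-≤1 : ∀ x ys → Unique ys → row x ys ≤ 1
  row-≤1 x []       _ = z≤n
  row-≤1 x (y ∷ ys) (y∉ys ∷ unique) with Q? (x , y)
  ... | yes q = ℕP.≤-reflexive (cong suc (row-empty ys
                  (All.map (λ y≢z qz → y≢z (functional q qz)) y∉ys)))
  ... | no _  = row-≤1 x ys unique

  -- summing the rows: each row contributes at most [x ∈ B]
  rows : ∀ xs ys → Unique ys → length (filter Q? (cartesianProduct xs ys)) ≤ length (filter (_∈? B) xs)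
  rows []       ys _      = z≤n
  rows (x ∷ xs) ys unique = begin
    length (filter Q? (map (x ,_) ys ++ cartesianProduct xs ys))
      ≡⟨ cong length (ListP.filter-++ Q? (map (x ,_) ys) (cartesianProduct xs ys)) ⟩
    length (filter Q? (map (x ,_) ys) ++ filter Q? (cartesianProduct xs ys))
      ≡⟨ ListP.length-++ (filter Q? (map (x ,_) ys)) ⟩
    row x ys ℕ.+ length (filter Q? (cartesianProduct xs ys))
      ≤⟨ row+rest (x ∈? B) ⟩
    length (filter (_∈? B) (x ∷ xs)) ∎
    where
    open ℕP.≤-Reasoning
    row+rest : Dec (x ∈ B)
      → row x ys ℕ.+ length (filter Q? (cartesianProduct xs ys)) ≤ length (filter (_∈? B) (x ∷ xs))
    row+rest (yes x∈B) rewrite ListP.filter-accept (_∈? B) {x} {xs} x∈B =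
      ℕP.+-mono-≤ (row-≤1 x ys unique) (rows xs ys unique)
    row+rest (no x∉B) rewrite ListP.filter-reject (_∈? B) {x} {xs} x∉B
                            | row-empty ys (All.universal (λ y q → x∉B (first∈B q)) ys) =
      rows xs ys unique

  bound : length (filter Q? (cartesianProduct (allFin n) (allFin n))) ≤ ∣ B ∣
  bound = ℕP.≤-trans (rows (allFin n) (allFin n) (allFin⁺ n)) (members-≤ B B (λ x → x) (λ _ x∈B → x∈B))

⊝-cancelˡ : ∀ {n} (G : FinAbGroup n) x {y y'} → _⊝_ G x y ≡ _⊝_ G x y' → y ≡ y'
⊝-cancelˡ G x x-y≡x-y' = ⁻¹-injective (∙-cancelˡ x _ _ x-y≡x-y')
  where
  group : Group _ _
  group = record { isGroup = IsAbelianGroup.isGroup (isAbelianGroup G) }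
  open GroupProperties group using (⁻¹-injective; ∙-cancelˡ)

N≤∣A∣ : ∀ {n m} (G : FinAbGroup n) (A : Fin m → Subset n) j δ → N G A j δ ≤ ∣ A j ∣
N≤∣A∣ G A j δ = FunctionalPairCount.bound _ (A j) (λ q → proj₁ (proj₁ q))
  (λ {x} q q' → ⊝-cancelˡ G x (trans (proj₂ q) (sym (proj₂ q'))))

mainTheorem9 : (n m : ℕ) (G : FinAbGroup n) (A : Fin m → Subset n) (k : Fin m → ℕ) (ℓ : ℤ)
    → IsRWEDF G A k ℓ
    → (∀ i j → i ≢ j → Coprime (k i) (k j))
    → IsBimodal G A k
mainTheorem9 n m G A k ℓ (_ , _ , ∣A∣≡k , weighted-sum) k-coprime j δ δ≢0
  with isolate-summand (λ i → toℚᵘ (frac (N G A i δ) (k i))) k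
         (λ i → ·∈ℤ-frac (N G A i δ) (k i)) k-coprime j
... | r , e , sum≃ , e·r , kj⊥e =
  frac-extremal (N G A j δ) (k j) (e ℕ.* e) Nj≤kj
    (·∈ℤ-complement (toℚᵘ (frac (N G A j δ) (k j))) r ℓ summands≃ℓ e·r) (coprime-* kj⊥e kj⊥e)
  where
  summands≃ℓ : toℚᵘ (frac (N G A j δ) (k j)) ℚᵘ.+ r ≃ toℚᵘ (ℓ ℚ./ 1)
  summands≃ℓ = ℚᵘP.≃-trans (ℚᵘP.≃-sym sum≃)
    (ℚᵘP.≃-trans (ℚᵘP.≃-sym (toℚᵘ-sumℚ (λ i → frac (N G A i δ) (k i))))
      (ℚP.toℚᵘ-cong (weighted-sum δ δ≢0)))

  Nj≤kj : N G A j δ ≤ k j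
  Nj≤kj = subst (N G A j δ ≤_) (∣A∣≡k j) (N≤∣A∣ G A j δ)
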